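{- Let $S$ be a completely simple semigroup with $n$ minimal left ideals. Then the chromatic number of $\mathcal{I}n(S)$ is $\chi(\mathcal{I}n(S))=n-1$.
   Context: A semigroup $S$ is completely simple if it has no proper two-sided ideal and contains a primitive idempotent (an idempotent $e$ minimal among idempotents under $e\le f\iff ef=fe=e$). A left ideal is a non-empty $I\subseteq S$ with $SI\subseteq I$; it is nontrivial if $I\neq S$ and minimal if it properly contains no left ideal. The inclusion ideal graph $\mathcal{I}n(S)$ is the simple undirected graph whose vertices are the nontrivial left ideals of $S$, with distinct $I,J$ adjacent iff $I\subset J$ or $J\subset I$. -}

module Defs where

open import Level using (Level; _⊔_) renaming (suc to lsuc)
open import Data.Nat using (ℕ; _<_)
open import Data.Fin using (Fin)
open import Data.Product using (Σ; ∃; _×_; proj₁)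
open import Data.Sum using (_⊎_)
open import Relation.Nullary using (¬_)
open import Relation.Binary.PropositionalEquality using (_≡_; _≢_)
open import Relation.Unary using (Pred; _∈_; _⊆_; _⊂_; _≐_; Satisfiable; U)
open import Algebra.Core using (Op₂)

record Graph (v e : Level) : Set (lsuc (v ⊔ e)) where
  field
    Vertex : Set v
    Adj    : Vertex → Vertex → Set e

Colourable : ∀ {v e} → Graph v e → ℕ → Set (v ⊔ e)
Colourable G k =
  Σ (Vertex → Fin k) λ c → ∀ x y → Adj x y → c x ≢ c y
  where open Graph G

ChromaticNumberIs : ∀ {v e} → Graph v e → ℕ → Set (v ⊔ e)
ChromaticNumberIs G m = Colourable G m × (∀ k → k < m → ¬ Colourable G k)

module SemigroupNotions {a : Level} {S : Set a} (_∙_ : Op₂ S) where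

  IsLeftIdeal : Pred S a → Set a
  IsLeftIdeal I = Satisfiable I × (∀ s x → x ∈ I → (s ∙ x) ∈ I)

  IsIdeal : Pred S a → Set a
  IsIdeal I = Satisfiable I × (∀ s x → x ∈ I → (s ∙ x) ∈ I)
                            × (∀ s x → x ∈ I → (x ∙ s) ∈ I)

  NoProperIdeal : Set (lsuc a)
  NoProperIdeal = ∀ I → IsIdeal I → U ⊆ I

  IsIdempotent : S → Set a
  IsIdempotent e = e ∙ e ≡ e

  _≤E_ : S → S → Set a
  e ≤E f = (e ∙ f ≡ e) × (f ∙ e ≡ e)

  IsPrimitiveIdempotent : S → Set a
  IsPrimitiveIdempotent e =
    IsIdempotent e × (∀ f → IsIdempotent f → f ≤E e → f ≡ e)

  IsCompletelySimple : Set (lsuc a)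
  IsCompletelySimple = NoProperIdeal × ∃ IsPrimitiveIdempotent

  IsMinimalLeftIdeal : Pred S a → Set (lsuc a)
  IsMinimalLeftIdeal I = IsLeftIdeal I × (∀ J → IsLeftIdeal J → ¬ (J ⊂ I))

  IsNontrivialLeftIdeal : Pred S a → Set a
  IsNontrivialLeftIdeal I = IsLeftIdeal I × ¬ (U ⊆ I)

  HasNMinimalLeftIdeals : ℕ → Set (lsuc a)
  HasNMinimalLeftIdeals n =
    Σ (Fin n → Pred S a) λ L →
        (∀ i → IsMinimalLeftIdeal (L i))
      × (∀ i j → L i ≐ L j → i ≡ j)
      × (∀ I → IsMinimalLeftIdeal I → ∃ λ i → I ≐ L i)

  InclusionIdealGraph : Graph (lsuc a) a
  InclusionIdealGraph = record
    { Vertex = Σ (Pred S a) IsNontrivialLeftIdeal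
    ; Adj    = λ I J → (proj₁ I ⊂ proj₁ J) ⊎ (proj₁ J ⊂ proj₁ I)
    }

-- Every element of S lies in one of the minimal left ideals L₁, …, Lₙ: their union is a
-- two-sided ideal, and it is nonempty because S e is minimal for a primitive idempotent e.
-- A left ideal I is therefore ranked by the number of Lᵢ it contains; this number lies in
-- [1, n - 1] for a nontrivial I and strictly increases along strict inclusions, so
-- "rank - 1" is a proper colouring with n - 1 colours.  Conversely, distinct minimal left
-- ideals are disjoint, so the unions L₁ ∪ … ∪ Lⱼ for j < n form a chain of n - 1
-- nontrivial left ideals, i.e. a clique.
module Submission where

open import Defs
open import Level using (Level)
open import Function using (_∘_)
open import Data.Nat using (ℕ; suc; _∸_; _≤_; _<_; s≤s; z≤n)
open import Data.Nat.Properties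
  using (<⇒≢; >⇒≢; ∸-monoˡ-<; ≤-trans; <⇒≤; <-irrefl)
open import Data.Fin using (Fin; zero; suc; toℕ; fromℕ<)
open import Data.Fin.Properties using (toℕ-fromℕ<; pigeonhole)
open import Data.Fin.Subset using (Subset; ∣_∣)
  renaming (_∈_ to _∈ˢ_; _∉_ to _∉ˢ_; _⊂_ to _⊂ˢ_)
open import Data.Fin.Subset.Properties
  using (p⊂q⇒∣p∣<∣q∣; ∣⊥∣≡0; ∣⊤∣≡n; ∉⊥; ∈⊤; ⊆-min; ⊆-max)
open import Data.Vec using (tabulate)
open import Data.Vec.Properties using (lookup∘tabulate; lookup⇒[]=; []=⇒lookup)
open import Data.Bool using (T)
open import Data.Product using (∃; ∃₂; _×_; _,_; proj₁; proj₂)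
open import Data.Sum as Sum using (_⊎_; inj₁; [_,_]′)
open import Data.Unit using (tt)
open import Relation.Nullary using (¬_; does)
open import Relation.Nullary.Decidable using (dec-true; toWitness; isYes≗does)
open import Relation.Unary using (Pred; _∈_; _∉_; _⊆_; _⊂_; _≐_; _∩_; _⊢_; U)
open import Algebra.Core using (Op₂)
open import Algebra.Structures using (IsSemigroup)
open import Relation.Binary.PropositionalEquality
  using (_≡_; _≢_; refl; sym; trans; cong; subst; module ≡-Reasoning)
open import Axiom.ExcludedMiddle using (ExcludedMiddle)
open import Axiom.DoubleNegationElimination using (DoubleNegationElimination; em⇒dne)

module _ {v e} (G : Graph v e) where
  open Graph G

  rank⇒Colourable : ∀ {k} (r : Vertex → ℕ) → (∀ x → r x < k) →
                    (∀ x y → Adj x y → r x < r y ⊎ r y < r x) → Colourable G k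
  rank⇒Colourable r r<k comparable = colour , proper
    where
    colour : Vertex → Fin _
    colour x = fromℕ< (r<k x)

    proper : ∀ x y → Adj x y → colour x ≢ colour y
    proper x y xy same = [ <⇒≢ , >⇒≢ ]′ (comparable x y xy) (begin
      r x               ≡⟨ toℕ-fromℕ< (r<k x) ⟨
      toℕ (colour x)    ≡⟨ cong toℕ same ⟩
      toℕ (colour y)    ≡⟨ toℕ-fromℕ< (r<k y) ⟩
      r y               ∎)
      where open ≡-Reasoning

  clique⇒¬Colourable : ∀ {m} (f : Fin m → Vertex) →
                       (∀ {i j} → toℕ i < toℕ j → Adj (f i) (f j)) →
                       ∀ k → k < m → ¬ Colourable G k
  clique⇒¬Colourable f adjacent k k<m (c , proper)
    with i , j , i<j , same ← pigeonhole k<m (c ∘ f)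
    = proper (f i) (f j) (adjacent i<j) same

module LeftIdeals {a} {S : Set a} (_∙_ : Op₂ S) (isSemigroup : IsSemigroup _≡_ _∙_) where
  open SemigroupNotions _∙_
  open IsSemigroup isSemigroup using (assoc)

  private
    variable
      I J M N : Pred S a
      b x y z : S

  S∙_ : S → Pred S a
  S∙ x = λ z → ∃ λ s → z ≡ s ∙ x

  S∙-isLeftIdeal : ∀ x → IsLeftIdeal (S∙ x)
  S∙-isLeftIdeal x = (x ∙ x , x , refl) , λ { t _ (s , refl) → t ∙ s , sym (assoc t s x) }

  S∙-least : IsLeftIdeal I → x ∈ I → S∙ x ⊆ I
  S∙-least (_ , closed) x∈I (s , refl) = closed s _ x∈I

  _∙ʳ_ : Pred S a → S → Pred S a
  I ∙ʳ s = λ z → ∃ λ y → y ∈ I × z ≡ y ∙ s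

  ∙ʳ-isLeftIdeal : IsLeftIdeal I → ∀ s → IsLeftIdeal (I ∙ʳ s)
  ∙ʳ-isLeftIdeal ((y , y∈I) , closed) s =
    (y ∙ s , y , y∈I , refl) ,
    λ { t _ (y , y∈I , refl) → t ∙ y , closed t y y∈I , sym (assoc t y s) }

  S∙_∙S : S → Pred S a
  S∙ b ∙S = λ z → ∃₂ λ x y → z ≡ x ∙ (b ∙ y)

  S∙∙S-isIdeal : ∀ b → IsIdeal (S∙ b ∙S)
  S∙∙S-isIdeal b =
    (b ∙ (b ∙ b) , b , b , refl) ,
    (λ { t _ (x , y , refl) → t ∙ x , y , sym (assoc t x (b ∙ y)) }) ,
    (λ { t _ (x , y , refl) → x , y ∙ t , trans (assoc x (b ∙ y) t) (cong (x ∙_) (assoc b y t)) })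

  -- With c = e x and d = e y e we get c b d = e, and then d c b is an idempotent below e.
  idempotent-below : ∀ {e} → IsIdempotent e → b ∙ e ≡ b → e ≡ x ∙ (b ∙ y) →
                     ∃ λ s → IsIdempotent (s ∙ b) × (s ∙ b) ≤E e
  idempotent-below {b} {x} {y} {e} ee≡e be≡b e≡xby = d ∙ c , ff≡f , fe≡f , ef≡f
    where
    open ≡-Reasoning
    c d : S
    c = e ∙ x
    d = e ∙ (y ∙ e)

    de≡d : d ∙ e ≡ d
    de≡d = trans (assoc e (y ∙ e) e) (cong (e ∙_) (trans (assoc y e e) (cong (y ∙_) ee≡e)))

    ed≡d : e ∙ d ≡ d
    ed≡d = trans (sym (assoc e e (y ∙ e))) (cong (_∙ (y ∙ e)) ee≡e)

    cbd≡e : c ∙ (b ∙ d) ≡ e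
    cbd≡e = begin
      (e ∙ x) ∙ (b ∙ (e ∙ (y ∙ e)))  ≡⟨ cong ((e ∙ x) ∙_) (assoc b e (y ∙ e)) ⟨
      (e ∙ x) ∙ ((b ∙ e) ∙ (y ∙ e))  ≡⟨ cong (λ w → (e ∙ x) ∙ (w ∙ (y ∙ e))) be≡b ⟩
      (e ∙ x) ∙ (b ∙ (y ∙ e))        ≡⟨ assoc e x (b ∙ (y ∙ e)) ⟩
      e ∙ (x ∙ (b ∙ (y ∙ e)))        ≡⟨ cong (λ w → e ∙ (x ∙ w)) (assoc b y e) ⟨
      e ∙ (x ∙ ((b ∙ y) ∙ e))        ≡⟨ cong (e ∙_) (assoc x (b ∙ y) e) ⟨
      e ∙ ((x ∙ (b ∙ y)) ∙ e)        ≡⟨ cong (λ w → e ∙ (w ∙ e)) e≡xby ⟨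
      e ∙ (e ∙ e)                    ≡⟨ cong (e ∙_) ee≡e ⟩
      e ∙ e                          ≡⟨ ee≡e ⟩
      e                              ∎

    ff≡f : ((d ∙ c) ∙ b) ∙ ((d ∙ c) ∙ b) ≡ (d ∙ c) ∙ b
    ff≡f = begin
      ((d ∙ c) ∙ b) ∙ ((d ∙ c) ∙ b)  ≡⟨ assoc (d ∙ c) b ((d ∙ c) ∙ b) ⟩
      (d ∙ c) ∙ (b ∙ ((d ∙ c) ∙ b))  ≡⟨ cong (λ w → (d ∙ c) ∙ (b ∙ w)) (assoc d c b) ⟩
      (d ∙ c) ∙ (b ∙ (d ∙ (c ∙ b)))  ≡⟨ cong ((d ∙ c) ∙_) (assoc b d (c ∙ b)) ⟨
      (d ∙ c) ∙ ((b ∙ d) ∙ (c ∙ b))  ≡⟨ assoc d c ((b ∙ d) ∙ (c ∙ b)) ⟩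
      d ∙ (c ∙ ((b ∙ d) ∙ (c ∙ b)))  ≡⟨ cong (d ∙_) (assoc c (b ∙ d) (c ∙ b)) ⟨
      d ∙ ((c ∙ (b ∙ d)) ∙ (c ∙ b))  ≡⟨ cong (λ w → d ∙ (w ∙ (c ∙ b))) cbd≡e ⟩
      d ∙ (e ∙ (c ∙ b))              ≡⟨ assoc d e (c ∙ b) ⟨
      (d ∙ e) ∙ (c ∙ b)              ≡⟨ cong (_∙ (c ∙ b)) de≡d ⟩
      d ∙ (c ∙ b)                    ≡⟨ assoc d c b ⟨
      (d ∙ c) ∙ b                    ∎

    fe≡f : ((d ∙ c) ∙ b) ∙ e ≡ (d ∙ c) ∙ b
    fe≡f = trans (assoc (d ∙ c) b e) (cong ((d ∙ c) ∙_) be≡b)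

    ef≡f : e ∙ ((d ∙ c) ∙ b) ≡ (d ∙ c) ∙ b
    ef≡f = trans (sym (assoc e (d ∙ c) b))
                 (cong (_∙ b) (trans (sym (assoc e d c)) (cong (_∙ c) ed≡d)))

  module Chain {m} (L : Fin (suc m) → Pred S a) (L-left : ∀ i → IsLeftIdeal (L i))
               (disjoint : ∀ {i j x} → x ∈ L i → x ∈ L j → i ≡ j) where

    ⋃< : ℕ → Pred S a
    ⋃< k = λ z → ∃ λ i → toℕ i < k × z ∈ L i

    point : Fin (suc m) → S
    point i = proj₁ (proj₁ (L-left i))

    point∈⋃< : ∀ {i k} → toℕ i < k → point i ∈ ⋃< k
    point∈⋃< {i} i<k = i , i<k , proj₂ (proj₁ (L-left i))

    point∈⋃<⁻ : ∀ {i k} → point i ∈ ⋃< k → toℕ i < k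
    point∈⋃<⁻ {i} (j , j<k , pᵢ∈Lⱼ) with refl ← disjoint (proj₂ (proj₁ (L-left i))) pᵢ∈Lⱼ = j<k

    ⋃<-mono : ∀ {k k′} → k ≤ k′ → ⋃< k ⊆ ⋃< k′
    ⋃<-mono k≤k′ (i , i<k , z∈Lᵢ) = i , ≤-trans i<k k≤k′ , z∈Lᵢ

    initialSegment : Fin m → Graph.Vertex InclusionIdealGraph
    initialSegment j =
      ⋃< (suc (toℕ j)) ,
      ((point zero , point∈⋃< (s≤s z≤n)) ,
       λ { s z (i , i<k , z∈Lᵢ) → i , i<k , proj₂ (L-left i) s z z∈Lᵢ }) ,
      λ U⊆ → <-irrefl refl (point∈⋃<⁻ {suc j} (U⊆ tt))

    initialSegment-⊂ : ∀ {j j′} → toℕ j < toℕ j′ →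
                       proj₁ (initialSegment j) ⊂ proj₁ (initialSegment j′)
    initialSegment-⊂ {j} j<j′ =
      ⋃<-mono (s≤s (<⇒≤ j<j′)) ,
      λ ⊆⋃ → <-irrefl refl (point∈⋃<⁻ {suc j} (⊆⋃ (point∈⋃< (s≤s j<j′))))

    ¬colourable : ∀ k → k < m → ¬ Colourable InclusionIdealGraph k
    ¬colourable = clique⇒¬Colourable InclusionIdealGraph initialSegment (inj₁ ∘ initialSegment-⊂)

  module Classical (em : ExcludedMiddle a) where
    private
      dne : DoubleNegationElimination a
      dne = em⇒dne em

    ⊈⇒∃∉ : ¬ (J ⊆ I) → ∃ λ z → z ∈ J × z ∉ I
    ⊈⇒∃∉ J⊈I = dne λ none → J⊈I λ z∈J → dne λ z∉I → none (_ , z∈J , z∉I)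

    U⊈⇒∃∉ : ¬ (U ⊆ I) → ∃ λ z → z ∉ I
    U⊈⇒∃∉ U⊈I = dne λ none → U⊈I λ {z} _ → dne λ z∉I → none (z , z∉I)

    minimal-⊆ : IsMinimalLeftIdeal M → IsLeftIdeal J → J ⊆ M → M ⊆ J
    minimal-⊆ (_ , noSmaller) J-left J⊆M = dne λ M⊈J → noSmaller _ J-left (J⊆M , M⊈J)

    minimal⊆-of-meet : IsMinimalLeftIdeal M → IsLeftIdeal I → x ∈ M → x ∈ I → M ⊆ I
    minimal⊆-of-meet {x = x} M-min@(M-left , _) I-left x∈M x∈I =
      S∙-least I-left x∈I ∘ minimal-⊆ M-min (S∙-isLeftIdeal x) (S∙-least M-left x∈M)

    minimal-meet⇒≐ : IsMinimalLeftIdeal M → IsMinimalLeftIdeal N → x ∈ M → x ∈ N → M ≐ N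
    minimal-meet⇒≐ M-min N-min x∈M x∈N =
      minimal⊆-of-meet M-min (proj₁ N-min) x∈M x∈N ,
      minimal⊆-of-meet N-min (proj₁ M-min) x∈N x∈M

    -- A left ideal J ⊆ M s pulls back to the left ideal {y ∈ M ∣ y s ∈ J} ⊆ M.
    minimal-∙ʳ : IsMinimalLeftIdeal M → ∀ s → IsMinimalLeftIdeal (M ∙ʳ s)
    minimal-∙ʳ {M} M-min@(M-left , _) s =
      ∙ʳ-isLeftIdeal M-left s ,
      λ { J J-left (J⊆Ms , Ms⊈J) → Ms⊈J λ { (y , y∈M , refl) →
            proj₂ (minimal-⊆ M-min (preimage-isLeftIdeal J J-left J⊆Ms) proj₁ y∈M) } }
      where
      preimage-isLeftIdeal : ∀ J → IsLeftIdeal J → J ⊆ M ∙ʳ s → IsLeftIdeal (M ∩ ((_∙ s) ⊢ J))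
      preimage-isLeftIdeal J ((z , z∈J) , closed) J⊆Ms with J⊆Ms z∈J
      ... | y , y∈M , refl =
        (y , y∈M , z∈J) ,
        λ t y (y∈M , ys∈J) → proj₂ M-left t y y∈M , subst J (sym (assoc t y s)) (closed t _ ys∈J)

    module _ (simple : NoProperIdeal) where

      primitive⇒S∙-minimal : ∀ {e} → IsPrimitiveIdempotent e → IsMinimalLeftIdeal (S∙ e)
      primitive⇒S∙-minimal {e} (ee≡e , below⇒≡e) =
        S∙-isLeftIdeal e ,
        λ { J J-left@((b , b∈J) , _) (J⊆Se , Se⊈J) →
              Se⊈J (S∙-least J-left (e∈J J J-left b∈J (J⊆Se b∈J))) }
        where
        e∈J : ∀ J → IsLeftIdeal J → b ∈ J → b ∈ S∙ e → e ∈ J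
        e∈J {b} J (_ , closed) b∈J (s , refl) =
          let x , y , e≡xby    = simple _ (S∙∙S-isIdeal (s ∙ e)) {e} tt
              t , f-idem , f≤e = idempotent-below ee≡e be≡b e≡xby
          in subst J (below⇒≡e _ f-idem f≤e) (closed t b b∈J)
          where
          be≡b : (s ∙ e) ∙ e ≡ s ∙ e
          be≡b = trans (assoc s e e) (cong (s ∙_) ee≡e)

      -- The union of a complete list of minimal left ideals is a two-sided ideal, hence S.
      minimal-cover : ∀ {n} (L : Fin n → Pred S a) → (∀ i → IsMinimalLeftIdeal (L i)) →
                      (∀ I → IsMinimalLeftIdeal I → ∃ λ i → I ≐ L i) →
                      IsMinimalLeftIdeal M → ∀ z → ∃ λ i → z ∈ L i
      minimal-cover {M} L L-min L-complete M-min@(((x , x∈M) , _) , _) z =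
        simple ⋃L ⋃L-isIdeal {z} tt
        where
        ⋃L : Pred S a
        ⋃L = λ y → ∃ λ i → y ∈ L i

        ⋃L-isIdeal : IsIdeal ⋃L
        ⋃L-isIdeal =
          (x , proj₁ (L-complete M M-min) , proj₁ (proj₂ (L-complete M M-min)) x∈M) ,
          (λ { s y (i , y∈Lᵢ) → i , proj₂ (proj₁ (L-min i)) s y y∈Lᵢ }) ,
          (λ { s y (i , y∈Lᵢ) → let j , Lᵢs≐Lⱼ = L-complete _ (minimal-∙ʳ (L-min i) s)
                                in j , proj₁ Lᵢs≐Lⱼ (y , y∈Lᵢ , refl) })

    module Rank {n} (L : Fin n → Pred S a) (L-min : ∀ i → IsMinimalLeftIdeal (L i))
                (cover : ∀ z → ∃ λ i → z ∈ L i) where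

      contained : Pred S a → Subset n
      contained I = tabulate λ i → does (em {L i ⊆ I})

      ∈contained⁺ : ∀ {i} → L i ⊆ I → i ∈ˢ contained I
      ∈contained⁺ {i = i} Lᵢ⊆I = lookup⇒[]= i _ (trans (lookup∘tabulate _ i) (dec-true em Lᵢ⊆I))

      ∈contained⁻ : ∀ {i} → i ∈ˢ contained I → L i ⊆ I
      ∈contained⁻ {I} {i} i∈ =
        toWitness {a? = em {L i ⊆ I}}
          (subst T (sym (trans (isYes≗does em)
                               (trans (sym (lookup∘tabulate _ i)) ([]=⇒lookup i∈)))) tt)

      meet⇒∈contained : IsLeftIdeal I → z ∈ I → ∀ {i} → z ∈ L i → i ∈ˢ contained I
      meet⇒∈contained I-left z∈I z∈Lᵢ = ∈contained⁺ (minimal⊆-of-meet (L-min _) I-left z∈Lᵢ z∈I)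

      ∉⇒∉contained : z ∉ I → ∀ {i} → z ∈ L i → i ∉ˢ contained I
      ∉⇒∉contained z∉I z∈Lᵢ i∈ = z∉I (∈contained⁻ i∈ z∈Lᵢ)

      contained-nonempty : IsLeftIdeal I → 0 < ∣ contained I ∣
      contained-nonempty {I} I-left@((z , z∈I) , _) =
        let i , z∈Lᵢ = cover z
        in subst (_< ∣ contained I ∣) (∣⊥∣≡0 n)
             (p⊂q⇒∣p∣<∣q∣ (⊆-min _ , i , meet⇒∈contained I-left z∈I z∈Lᵢ , ∉⊥))

      contained-proper : ¬ (U ⊆ I) → ∣ contained I ∣ < n
      contained-proper {I} U⊈I =
        let z , z∉I = U⊈⇒∃∉ U⊈I
            i , z∈Lᵢ = cover z
        in subst (∣ contained I ∣ <_) (∣⊤∣≡n n)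
             (p⊂q⇒∣p∣<∣q∣ (⊆-max _ , i , ∈⊤ , ∉⇒∉contained z∉I z∈Lᵢ))

      contained-⊂ : IsLeftIdeal J → I ⊂ J → contained I ⊂ˢ contained J
      contained-⊂ J-left (I⊆J , J⊈I) =
        let z , z∈J , z∉I = ⊈⇒∃∉ J⊈I
            i , z∈Lᵢ = cover z
        in (λ i∈ → ∈contained⁺ (I⊆J ∘ ∈contained⁻ i∈)) ,
           i , meet⇒∈contained J-left z∈J z∈Lᵢ , ∉⇒∉contained z∉I z∈Lᵢ

      colourable : Colourable InclusionIdealGraph (n ∸ 1)
      colourable = rank⇒Colourable InclusionIdealGraph rank rank<n∸1 λ I J →
        Sum.map (rank-mono I J) (rank-mono J I)
        where
        open Graph InclusionIdealGraph using (Vertex)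

        rank : Vertex → ℕ
        rank (I , _) = ∣ contained I ∣ ∸ 1

        rank<n∸1 : ∀ I → rank I < n ∸ 1
        rank<n∸1 (I , I-left , U⊈I) = ∸-monoˡ-< (contained-proper U⊈I) (contained-nonempty I-left)

        rank-mono : ∀ I J → proj₁ I ⊂ proj₁ J → rank I < rank J
        rank-mono (I , I-left , _) (J , J-left , _) I⊂J =
          ∸-monoˡ-< (p⊂q⇒∣p∣<∣q∣ (contained-⊂ J-left I⊂J)) (contained-nonempty I-left)

    minimal-list⇒¬colourable :
      ∀ {n} (L : Fin n → Pred S a) → (∀ i → IsMinimalLeftIdeal (L i)) →
      (∀ i j → L i ≐ L j → i ≡ j) →
      ∀ k → k < n ∸ 1 → ¬ Colourable InclusionIdealGraph k
    minimal-list⇒¬colourable {0} _ _ _ _ ()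
    minimal-list⇒¬colourable {suc m} L L-min L-inj =
      Chain.¬colourable L (proj₁ ∘ L-min) λ x∈Lᵢ x∈Lⱼ →
        L-inj _ _ (minimal-meet⇒≐ (L-min _) (L-min _) x∈Lᵢ x∈Lⱼ)

mainTheorem19 : ∀ {a : Level} → ExcludedMiddle a →
    (S : Set a) (_∙_ : Op₂ S) → IsSemigroup _≡_ _∙_ →
    SemigroupNotions.IsCompletelySimple _∙_ →
    (n : ℕ) → SemigroupNotions.HasNMinimalLeftIdeals _∙_ n →
    ChromaticNumberIs (SemigroupNotions.InclusionIdealGraph _∙_) (n ∸ 1)
mainTheorem19 em S _∙_ isSemigroup (simple , e , e-primitive) n (L , L-min , L-inj , L-complete) =
  Rank.colourable L L-min cover , minimal-list⇒¬colourable L L-min L-inj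
  where
  open LeftIdeals _∙_ isSemigroup
  open Classical em

  cover : ∀ z → ∃ λ i → z ∈ L i
  cover = minimal-cover simple L L-min L-complete (primitive⇒S∙-minimal simple e-primitive)
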